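{- Let $w$ be an infinite word. If $w$ is uniformly abelian-square-rich, then $w$ has bounded exponent, i.e. there is an integer $k\ge 2$ such that no factor of $w$ is of the form $u^k$ with $u$ nonempty.
   Context: An abelian square is a nonempty word $uv$ where $v$ is an anagram of $u$. For a finite word $v$, $\mathrm{AS}(v)$ is the number of distinct factors of $v$ that are abelian squares. An infinite word $w$ is uniformly abelian-square-rich if there exist $C>0$ and an integer $n_0$ such that $\mathrm{AS}(v)\ge C|v|^2$ for every factor $v$ of $w$ with $|v|\ge n_0$. -}

module Defs where

open import Data.Nat using (ℕ; zero; suc; _+_; _*_; _^_; _≤_)
open import Data.Fin using (Fin)
open import Data.List using (List; []; _∷_; _++_; length; concat; replicate)
open import Data.List.Relation.Unary.All using (All)
open import Data.List.Relation.Unary.Unique.Propositional using (Unique)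
open import Data.List.Relation.Binary.Permutation.Propositional using (_↭_)
open import Data.Product using (Σ; ∃; _×_; _,_)
open import Relation.Binary.PropositionalEquality using (_≡_)
open import Data.Empty using (⊥)

Word∞ : ℕ → Set
Word∞ q = ℕ → Fin q

slice : ∀ {q} → Word∞ q → ℕ → ℕ → List (Fin q)
slice w i zero    = []
slice w i (suc n) = w i ∷ slice w (suc i) n

FactorOf∞ : ∀ {q} → List (Fin q) → Word∞ q → Set
FactorOf∞ x w = ∃ λ i → slice w i (length x) ≡ x

FactorOf : ∀ {q} → List (Fin q) → List (Fin q) → Set
FactorOf x v = ∃ λ p → ∃ λ s → p ++ x ++ s ≡ v

AbelianSquare : ∀ {q} → List (Fin q) → Set
AbelianSquare {q} x =
  Σ (List (Fin q)) λ u → Σ (List (Fin q)) λ v →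
    (1 ≤ length u) × (v ↭ u) × (x ≡ u ++ v)

ASAtLeast : ∀ {q} → List (Fin q) → ℕ → Set
ASAtLeast {q} v N =
  Σ (List (List (Fin q))) λ xs →
    (length xs ≡ N) × Unique xs × All (λ x → FactorOf x v × AbelianSquare x) xs

-- Uniformly abelian-square-rich, with the constant C > 0 given as a
-- positive rational a / b :  b * AS(v) ≥ a * |v|^2.
UniformlyASRich : ∀ {q} → Word∞ q → Set
UniformlyASRich {q} w =
  Σ ℕ λ a → Σ ℕ λ b → (1 ≤ a) × (1 ≤ b) × Σ ℕ λ n₀ →
    ∀ (v : List (Fin q)) → FactorOf∞ v w → n₀ ≤ length v →
      Σ ℕ λ N → ASAtLeast v N × (a * (length v ^ 2) ≤ b * N)

pow : ∀ {q} → List (Fin q) → ℕ → List (Fin q)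
pow u k = concat (replicate k u)

BoundedExponent : ∀ {q} → Word∞ q → Set
BoundedExponent {q} w =
  Σ ℕ λ k → (2 ≤ k) ×
    (∀ (u : List (Fin q)) → 1 ≤ length u → FactorOf∞ (pow u k) w → ⊥)

-- A word of period p has, for each length, at most p distinct factors of that
-- length (a factor is determined by its starting position modulo p), so u^k with
-- |u| = p has at most p (kp + 1) distinct factors, abelian squares or not.
-- Uniform richness forces at least (a/b) (kp)^2 of them once kp ≥ n₀, and for
-- k > 2b this exceeds p (kp + 1). Hence k = 2 + 2b + n₀ is a bound on exponents.
module Submission where

open import Defs
open import Data.Nat using (ℕ; zero; suc; _+_; _*_; _^_; _≤_; _<_; z≤n; s≤s; NonZero; _%_; _/_)
open import Data.Nat.Properties
open import Data.Nat.DivMod using (m%n<n; m<n⇒m%n≡m; [m+n]%n≡m%n; m≡m%n+[m/n]*n)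
open import Data.Fin using (Fin; fromℕ<)
open import Data.Fin.Properties using (fromℕ<-cong)
open import Data.List using (List; []; _∷_; _++_; length; lookup; applyUpTo)
open import Data.List.Properties using (∷-injectiveˡ; ∷-injectiveʳ; length-++; length-++-≤ˡ; length-++-≤ʳ; length-applyUpTo; length-removeAt′)
open import Data.List.Relation.Unary.All as All using (All)
open import Data.List.Relation.Unary.AllPairs using ([]; _∷_)
open import Data.List.Relation.Unary.Any using (here; there; index; _─_)
open import Data.List.Relation.Unary.Unique.Propositional using (Unique)
open import Data.List.Membership.Propositional using (_∈_)
open import Data.List.Membership.Propositional.Properties using (∈-++⁺ˡ; ∈-++⁺ʳ; ∈-applyUpTo⁺)
open import Data.List.Relation.Binary.Subset.Propositional using (_⊆_)
open import Data.Product using (Σ; _×_; _,_)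
open import Data.Sum using (inj₁; inj₂)
open import Data.Empty using (⊥)
open import Relation.Binary.PropositionalEquality
open import Relation.Nullary using (contradiction)

module _ {A : Set} where

  ∈-─⁺ : ∀ {x y : A} {ys} (x∈ys : x ∈ ys) → y ∈ ys → x ≢ y → y ∈ (ys ─ x∈ys)
  ∈-─⁺ (here refl)   (here refl)   x≢y = contradiction refl x≢y
  ∈-─⁺ (here _)      (there y∈ys)  _   = y∈ys
  ∈-─⁺ (there _)     (here y≡z)    _   = here y≡z
  ∈-─⁺ (there x∈ys)  (there y∈ys)  x≢y = there (∈-─⁺ x∈ys y∈ys x≢y)

  Unique-⊆⇒length-≤ : {xs ys : List A} → Unique xs → xs ⊆ ys → length xs ≤ length ys
  Unique-⊆⇒length-≤ {[]}          _               _     = z≤n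
  Unique-⊆⇒length-≤ {x ∷ xs} {ys} (x∉xs ∷ unique) xs⊆ys = begin
    suc (length xs)              ≤⟨ s≤s (Unique-⊆⇒length-≤ unique xs⊆ys─x) ⟩
    suc (length (ys ─ x∈ys))     ≡⟨ sym (length-removeAt′ ys (index x∈ys)) ⟩
    length ys                    ∎
    where
    open ≤-Reasoning
    x∈ys : x ∈ ys
    x∈ys = xs⊆ys (here refl)
    xs⊆ys─x : xs ⊆ (ys ─ x∈ys)
    xs⊆ys─x y∈xs = ∈-─⁺ x∈ys (xs⊆ys (there y∈xs)) (All.lookup x∉xs y∈xs)

module _ {q : ℕ} where

  length-slice : ∀ (f : Word∞ q) i n → length (slice f i n) ≡ n
  length-slice f i zero    = refl
  length-slice f i (suc n) = cong suc (length-slice f (suc i) n)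

  slice-++ : ∀ (f : Word∞ q) i m n → slice f i (m + n) ≡ slice f i m ++ slice f (i + m) n
  slice-++ f i zero    n = cong (λ j → slice f j n) (sym (+-identityʳ i))
  slice-++ f i (suc m) n = cong (f i ∷_) (trans (slice-++ f (suc i) m n)
                                                (cong (λ j → slice f (suc i) m ++ slice f j n) (sym (+-suc i m))))

  slice-lookup : ∀ (f : Word∞ q) (u : List (Fin q)) →
                 (∀ i (i<|u| : i < length u) → f i ≡ lookup u (fromℕ< i<|u|)) →
                 slice f 0 (length u) ≡ u
  slice-lookup f []      _   = refl
  slice-lookup f (c ∷ u) f≡u = cong₂ _∷_ (f≡u 0 (s≤s z≤n))
    (trans (slice-suc 0 (length u)) (slice-lookup (λ i → f (suc i)) u (λ i i<|u| → f≡u (suc i) (s≤s i<|u|))))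
    where
    slice-suc : ∀ i n → slice f (suc i) n ≡ slice (λ j → f (suc j)) i n
    slice-suc i zero    = refl
    slice-suc i (suc n) = cong (f (suc i) ∷_) (slice-suc (suc i) n)

  prefix-of-slice : ∀ (f : Word∞ q) x s i n → x ++ s ≡ slice f i n → x ≡ slice f i (length x)
  prefix-of-slice f []      s i n       eq = refl
  prefix-of-slice f (c ∷ x) s i (suc n) eq =
    cong₂ _∷_ (∷-injectiveˡ eq) (prefix-of-slice f x s (suc i) n (∷-injectiveʳ eq))

  infix-of-slice : ∀ (f : Word∞ q) pre x s i n → pre ++ x ++ s ≡ slice f i n →
                   x ≡ slice f (length pre + i) (length x)
  infix-of-slice f []        x s i n       eq = prefix-of-slice f x s i n eq
  infix-of-slice f (c ∷ pre) x s i (suc n) eq =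
    trans (infix-of-slice f pre x s (suc i) n (∷-injectiveʳ eq))
          (cong (λ j → slice f j (length x)) (+-suc (length pre) i))

  infix-of-slice-length : ∀ (f : Word∞ q) pre x s i n → pre ++ x ++ s ≡ slice f i n → length x ≤ n
  infix-of-slice-length f pre x s i n eq = begin
    length x                  ≤⟨ length-++-≤ˡ x ⟩
    length (x ++ s)           ≤⟨ length-++-≤ʳ (x ++ s) {pre} ⟩
    length (pre ++ x ++ s)    ≡⟨ cong length eq ⟩
    length (slice f i n)      ≡⟨ length-slice f i n ⟩
    n                         ∎
    where open ≤-Reasoning

  slices : Word∞ q → ℕ → ℕ → List (List (Fin q))
  slices f zero    n = []
  slices f (suc p) n = applyUpTo (slice f p) (suc n) ++ slices f p n

  length-slices : ∀ f p n → length (slices f p n) ≡ p * suc n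
  length-slices f zero    n = refl
  length-slices f (suc p) n = trans (length-++ (applyUpTo (slice f p) (suc n)))
                                    (cong₂ _+_ (length-applyUpTo (slice f p) (suc n)) (length-slices f p n))

  slice-∈-slices : ∀ f {p n j L} → j < p → L ≤ n → slice f j L ∈ slices f p n
  slice-∈-slices f {suc p} (s≤s j≤p) L≤n with m≤n⇒m<n∨m≡n j≤p
  ... | inj₁ j<p  = ∈-++⁺ʳ _ (slice-∈-slices f j<p L≤n)
  ... | inj₂ refl = ∈-++⁺ˡ (∈-applyUpTo⁺ (slice f p) (s≤s L≤n))

  module Periodic (f : Word∞ q) (p : ℕ) .{{_ : NonZero p}} (periodic : ∀ i → f (i + p) ≡ f i) where

    slice-periodic : ∀ i n → slice f (i + p) n ≡ slice f i n
    slice-periodic i zero    = refl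
    slice-periodic i (suc n) = cong₂ _∷_ (periodic i) (slice-periodic (suc i) n)

    slice-+-multiple : ∀ m i n → slice f (i + m * p) n ≡ slice f i n
    slice-+-multiple zero    i n = cong (λ j → slice f j n) (+-identityʳ i)
    slice-+-multiple (suc m) i n = begin
      slice f (i + (p + m * p)) n  ≡⟨ cong (λ j → slice f j n) (sym (+-assoc i p (m * p))) ⟩
      slice f (i + p + m * p) n    ≡⟨ slice-+-multiple m (i + p) n ⟩
      slice f (i + p) n            ≡⟨ slice-periodic i n ⟩
      slice f i n                  ∎
      where open ≡-Reasoning

    slice-% : ∀ i n → slice f i n ≡ slice f (i % p) n
    slice-% i n = trans (cong (λ j → slice f j n) (m≡m%n+[m/n]*n i p)) (slice-+-multiple (i / p) (i % p) n)

    factor-of-slice-∈-slices : ∀ {x n} → FactorOf x (slice f 0 n) → x ∈ slices f p n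
    factor-of-slice-∈-slices {x} {n} (pre , s , eq) =
      subst (_∈ slices f p n) (sym x≡slice) (slice-∈-slices f (m%n<n j p) (infix-of-slice-length f pre x s 0 n eq))
      where
      j : ℕ
      j = length pre + 0
      x≡slice : x ≡ slice f (j % p) (length x)
      x≡slice = trans (infix-of-slice f pre x s 0 n eq) (slice-% j (length x))

    distinct-factors-≤ : ∀ {xs n} → Unique xs → All (λ x → FactorOf x (slice f 0 n)) xs → length xs ≤ p * suc n
    distinct-factors-≤ {xs} {n} unique factors =
      subst (length xs ≤_) (length-slices f p n)
            (Unique-⊆⇒length-≤ unique (λ x∈xs → factor-of-slice-∈-slices (All.lookup factors x∈xs)))

  cycle : (u : List (Fin q)) .{{_ : NonZero (length u)}} → Word∞ q
  cycle u i = lookup u (fromℕ< (m%n<n i (length u)))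

  cycle-periodic : ∀ (u : List (Fin q)) .{{_ : NonZero (length u)}} i → cycle u (i + length u) ≡ cycle u i
  cycle-periodic u i = cong (lookup u) (fromℕ<-cong _ _ ([m+n]%n≡m%n i (length u)) _ _)

  slice-cycle : ∀ (u : List (Fin q)) .{{_ : NonZero (length u)}} → slice (cycle u) 0 (length u) ≡ u
  slice-cycle u = slice-lookup (cycle u) u (λ i i<|u| → cong (lookup u) (fromℕ<-cong _ _ (m<n⇒m%n≡m i<|u|) _ _))

  pow-slice-cycle : ∀ (u : List (Fin q)) .{{_ : NonZero (length u)}} k → pow u k ≡ slice (cycle u) 0 (k * length u)
  pow-slice-cycle u zero    = refl
  pow-slice-cycle u (suc k) = sym (begin
    slice (cycle u) 0 (length u + k * length u)            ≡⟨ slice-++ (cycle u) 0 (length u) (k * length u) ⟩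
    slice (cycle u) 0 (length u) ++ slice (cycle u) (length u) (k * length u)
      ≡⟨ cong₂ _++_ (slice-cycle u) (Periodic.slice-periodic (cycle u) (length u) (cycle-periodic u) 0 (k * length u)) ⟩
    u ++ slice (cycle u) 0 (k * length u)                  ≡⟨ cong (u ++_) (pow-slice-cycle u k) ⟨
    u ++ pow u k                                           ∎)
    where open ≡-Reasoning

  length-pow : ∀ (u : List (Fin q)) k → length (pow u k) ≡ k * length u
  length-pow u zero    = refl
  length-pow u (suc k) = trans (length-++ u) (cong (length u +_) (length-pow u k))

  ASAtLeast-pow⇒≤ : ∀ (u : List (Fin q)) .{{_ : NonZero (length u)}} k {N} → ASAtLeast (pow u k) N → N ≤ length u * suc (k * length u)
  ASAtLeast-pow⇒≤ u k (xs , refl , unique , squares) =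
    Periodic.distinct-factors-≤ (cycle u) (length u) (cycle-periodic u) unique
      (All.map (λ (factor , _) → subst (FactorOf _) (pow-slice-cycle u k) factor) squares)

linear-<-quadratic : ∀ {a b k p} → 1 ≤ a → 1 ≤ p → b + b < k → b * (p * suc (k * p)) < a * (k * p) ^ 2
linear-<-quadratic {a@(suc _)} {b} {k@(suc _)} {p@(suc _)} _ _ b+b<k = begin-strict
  b * (p * suc T)              ≡⟨ cong (b *_) (*-suc p T) ⟩
  b * (p + p * T)              ≡⟨ *-distribˡ-+ b p (p * T) ⟩
  b * p + b * (p * T)          ≤⟨ +-monoˡ-≤ (b * (p * T)) (*-monoʳ-≤ b (m≤m*n p T)) ⟩
  b * (p * T) + b * (p * T)    ≡⟨ *-distribʳ-+ (p * T) b b ⟨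
  (b + b) * (p * T)            <⟨ *-monoˡ-< (p * T) b+b<k ⟩
  k * (p * T)                  ≡⟨ *-assoc k p T ⟨
  T * T                        ≡⟨ cong (T *_) (*-identityʳ T) ⟨
  T ^ 2                        ≤⟨ m≤n*m (T ^ 2) a ⟩
  a * T ^ 2                    ∎
  where
  open ≤-Reasoning
  T = k * p

proposition4 : (q : ℕ) (w : Word∞ q) → UniformlyASRich w → BoundedExponent w
proposition4 q w (a , b , 1≤a , _ , n₀ , rich) = k , s≤s (s≤s z≤n) , no-power
  where
  k : ℕ
  k = 2 + b + b + n₀

  no-power : ∀ (u : List (Fin q)) → 1 ≤ length u → FactorOf∞ (pow u k) w → ⊥
  no-power (c ∷ u′) _ u^k∈w = contradict (rich (pow u k) u^k∈w n₀≤|u^k|)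
    where
    u = c ∷ u′
    p = length u

    n₀≤|u^k| : n₀ ≤ length (pow u k)
    n₀≤|u^k| = subst (n₀ ≤_) (sym (length-pow u k)) (≤-trans (m≤n+m n₀ (2 + b + b)) (m≤m*n k p))

    contradict : Σ ℕ (λ N → ASAtLeast (pow u k) N × a * length (pow u k) ^ 2 ≤ b * N) → ⊥
    contradict (N , AS≥N , richness) =
      <⇒≱ (linear-<-quadratic {a} {b} {k} {p} 1≤a (s≤s z≤n) (s≤s (m≤n⇒m≤1+n (m≤m+n (b + b) n₀)))) (begin
        a * (k * p) ^ 2            ≡⟨ cong (λ n → a * n ^ 2) (length-pow u k) ⟨
        a * length (pow u k) ^ 2   ≤⟨ richness ⟩
        b * N                      ≤⟨ *-monoʳ-≤ b (ASAtLeast-pow⇒≤ u k AS≥N) ⟩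
        b * (p * suc (k * p))      ∎)
      where open ≤-Reasoning
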